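{- Let $T$ be a tournament and $x\in V(T)$. Then the union $Ac(T)(x)$ of all acyclic autonomous subsets of $T$ containing $x$ is the largest acyclic autonomous subset of $T$ containing $x$.
   Context: A tournament is a set with an irreflexive, antisymmetric, complete binary relation; a subset of vertices is acyclic if the induced tournament contains no $3$-cycle. A subset $A$ of vertices is autonomous if for all $x,x'\in A$ and $y\notin A$, $(x,y)$ is an edge iff $(x',y)$ is an edge. -}

module Defs where

open import Level using (Level; 0ℓ; suc)
open import Data.Product using (Σ; ∃; ∃-syntax; _×_; _,_)
open import Data.Sum using (_⊎_)
open import Relation.Nullary using (¬_)
open import Relation.Binary.PropositionalEquality using (_≡_; _≢_)
open import Relation.Unary using (Pred; _∈_; _∉_; _⊆_)
open import Function.Bundles using (_⇔_)

record Tournament : Set₁ where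
  field
    V        : Set
    _⇒_      : V → V → Set
    irrefl   : ∀ x → ¬ (x ⇒ x)
    antisym  : ∀ {x y} → x ⇒ y → y ⇒ x → x ≡ y
    complete : ∀ {x y} → x ≢ y → (x ⇒ y) ⊎ (y ⇒ x)

module _ (T : Tournament) where
  open Tournament T

  Acyclic : ∀ {ℓ} → Pred V ℓ → Set ℓ
  Acyclic A = ¬ (∃[ a ] ∃[ b ] ∃[ c ]
    (a ∈ A × b ∈ A × c ∈ A × a ⇒ b × b ⇒ c × c ⇒ a))

  Autonomous : ∀ {ℓ} → Pred V ℓ → Set ℓ
  Autonomous A = ∀ {a a' y} → a ∈ A → a' ∈ A → y ∉ A → (a ⇒ y) ⇔ (a' ⇒ y)

  Ac : V → Pred V (suc 0ℓ)
  Ac x y = ∃[ A ] (Acyclic {0ℓ} A × Autonomous A × x ∈ A × y ∈ A)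

module Submission where

open import Defs
open import Level using (Level; 0ℓ)
open import Data.Empty using (⊥; ⊥-elim)
open import Data.Product using (_×_; _,_)
open import Data.Sum using (inj₁; inj₂; fromInj₂; swap)
open import Function using (_∘_)
open import Function.Bundles using (_⇔_; Equivalence)
open import Function.Construct.Composition using (_⇔-∘_)
open import Function.Construct.Identity using (⇔-id)
open import Function.Construct.Symmetry using (⇔-sym)
open import Relation.Nullary using (¬_; yes; no)
open import Relation.Nullary.Decidable.Core using (¬¬-excluded-middle)
open import Relation.Binary.PropositionalEquality using (refl)
open import Relation.Unary using (Pred; _∈_; _∉_; _⊆_; _∪_; ｛_｝)

-- A 3-cycle meets an acyclic autonomous set in at most one vertex: two
-- vertices inside force the third inside too, by autonomy. Hence the union of
-- two acyclic autonomous sets is acyclic, and if they share x it is also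
-- autonomous. Applying this to the three sets witnessing the vertices of a
-- 3-cycle in Ac(T)(x) shows Ac(T)(x) is acyclic; its autonomy is immediate
-- since every member is seen from outside exactly as x is.

module _ (T : Tournament) where
  open Tournament T

  private
    variable
      ℓ : Level
      A B S : Pred V ℓ
      a b c x : V

  Cycle : V → V → V → Set
  Cycle a b c = a ⇒ b × b ⇒ c × c ⇒ a

  rotate : Cycle a b c → Cycle b c a
  rotate (ab , bc , ca) = bc , ca , ab

  cycle-closed : Autonomous T S → Cycle a b c → a ∈ S → b ∈ S → ¬ c ∉ S
  cycle-closed auS (_ , bc , ca) aS bS c∉S
    with antisym (Equivalence.to (auS bS aS c∉S) bc) ca
  ... | refl = irrefl _ ca

  cycle-successor-∉ : Acyclic T S → Autonomous T S → Cycle a b c → a ∈ S → b ∉ S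
  cycle-successor-∉ acS auS cyc aS bS = ¬¬-excluded-middle λ where
    (yes cS)  → acS (_ , _ , _ , aS , bS , cS , cyc)
    (no c∉S) → cycle-closed auS cyc aS bS c∉S

  ∪-cycle-through-left : Acyclic T A → Autonomous T A → Acyclic T B → Autonomous T B →
                         Cycle a b c → a ∈ A → b ∈ A ∪ B → c ∈ A ∪ B → ⊥
  ∪-cycle-through-left acA auA acB auB cyc aA b∈ c∈ =
    cycle-successor-∉ acB auB (rotate cyc)
      (fromInj₂ (⊥-elim ∘ cycle-successor-∉ acA auA cyc aA) b∈)
      (fromInj₂ (λ cA → ⊥-elim (cycle-successor-∉ acA auA (rotate (rotate cyc)) cA aA)) c∈)

  ∪-acyclic : Acyclic T A → Autonomous T A → Acyclic T B → Autonomous T B →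
              Acyclic T (A ∪ B)
  ∪-acyclic acA auA acB auB (_ , _ , _ , inj₁ aA , b∈ , c∈ , cyc) =
    ∪-cycle-through-left acA auA acB auB cyc aA b∈ c∈
  ∪-acyclic acA auA acB auB (_ , _ , _ , inj₂ aB , b∈ , c∈ , cyc) =
    ∪-cycle-through-left acB auB acA auA cyc aB (swap b∈) (swap c∈)

  autonomous-via : (x : V) → (∀ {a y} → a ∈ S → y ∉ S → (a ⇒ y) ⇔ (x ⇒ y)) →
                   Autonomous T S
  autonomous-via x seen aS a'S y∉S = ⇔-sym (seen a'S y∉S) ⇔-∘ seen aS y∉S

  ∪-autonomous : Autonomous T A → Autonomous T B → x ∈ A → x ∈ B →
                 Autonomous T (A ∪ B)
  ∪-autonomous {x = x} auA auB xA xB = autonomous-via x λ where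
    (inj₁ aA) y∉ → auA aA xA (y∉ ∘ inj₁)
    (inj₂ aB) y∉ → auB aB xB (y∉ ∘ inj₂)

  ｛｝-acyclic : Acyclic T ｛ x ｝
  ｛｝-acyclic (_ , _ , _ , refl , refl , refl , xx , _) = irrefl _ xx

  ｛｝-autonomous : Autonomous T ｛ x ｝
  ｛｝-autonomous refl refl _ = ⇔-id _

  ∈-Ac : x ∈ Ac T x
  ∈-Ac {x} = ｛ x ｝ , ｛｝-acyclic , ｛｝-autonomous , refl , refl

  Ac-acyclic : Acyclic T (Ac T x)
  Ac-acyclic ( _ , _ , _
             , (A , acA , auA , xA , aA)
             , (B , acB , auB , xB , bB)
             , (C , acC , auC , _  , cC)
             , cyc) =
    ∪-acyclic (∪-acyclic acA auA acB auB) (∪-autonomous auA auB xA xB) acC auC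
      (_ , _ , _ , inj₁ (inj₁ aA) , inj₁ (inj₂ bB) , inj₂ cC , cyc)

  Ac-autonomous : Autonomous T (Ac T x)
  Ac-autonomous {x} = autonomous-via x λ where
    (A , acA , auA , xA , aA) y∉ → auA aA xA (λ yA → y∉ (A , acA , auA , xA , yA))

lemma3p3 : (T : Tournament) (x : Tournament.V T) →
    Acyclic T (Ac T x) × Autonomous T (Ac T x) × x ∈ Ac T x ×
    ((A : Pred (Tournament.V T) 0ℓ) → Acyclic T A → Autonomous T A → x ∈ A → A ⊆ Ac T x)
lemma3p3 T x =
  Ac-acyclic T , Ac-autonomous T , ∈-Ac T , λ A acA auA xA aA → A , acA , auA , xA , aA
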